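{- Let $\mathbf{J}:\mathbb{Q}\cap(0,1)\to\mathbb{Q}\cap(0,1)$ be the map defined in the context. For every $x\in\mathbb{Q}\cap(0,1)$, $$\mathbf J\!\left(\frac{1}{1+x}\right)=\frac{\mathbf J(x)}{1+\mathbf J(x)},\qquad \mathbf J\!\left(\frac{x}{1+x}\right)=\frac{1}{1+\mathbf J(x)}.$$
   Context: Let $X$ be the set of finite tuples $(n_1,\dots,n_k)$ with $k\ge1$ and all $n_i$ positive integers. The bijection $\theta:X\to\mathbb{Q}\cap(0,1)$ is $\theta(n_1,\dots,n_k)=[0,n_1,\dots,n_{k-1},n_k+1]$, where $[0,a_1,\dots,a_m]=1/(a_1+1/(\cdots+1/a_m))$. Write $1_m$ for a block of $m$ consecutive entries equal to $1$. For $x=(n_1,\dots,n_k)\in X$ with $k\ge2$, first form the formal sequence $$(1_{n_1-1},2,1_{n_2-2},2,1_{n_3-2},2,\dots,1_{n_{k-1}-2},2,1_{n_k-1}).$$ Then reduce it, one rule at a time, until all entries are $\ge1$, using two rules: - a block $1_0$ is deleted, i.e. $(\dots,m,1_0,n,\dots)=(\dots,m,n,\dots)$, including at either end; - a block $1_{ -1}$ merges its neighbours, i.e. $(\dots,m,1_{ -1},n,\dots)=(\dots,m+n-1,\dots)$. The result is $\mathbf J(x)\in X$. For example, $\mathbf J(1,1,1,1)=(4)$ and $\mathbf J(2,2,2,2)=(1,2,2,2,1)$. For $k=1$, set $\mathbf J((n_1))=(1_{n_1})$. On rationals, $\mathbf J$ is transported by $\theta$: $\mathbf J(\theta(x)):=\theta(\mathbf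 J(x))$. Equivalently, for $n_k\ge2$, $$\mathbf J([0,n_1,\dots,n_k])=[0,1_{n_1-1},2,1_{n_2-2},2,\dots,1_{n_{k-1}-2},2,1_{n_k-1}]$$ with the same reduction rules. For example, $\mathbf J(1/2)=1/2$, $\mathbf J(1/3)=2/3$ and $\mathbf J(2/3)=1/3$. -}

module Defs where

open import Data.Nat using (ℕ; zero; suc; _≤_; _∸_)
import Data.Nat as ℕ
open import Data.Integer using (ℤ; +_; -[1+_]; _⊖_)
open import Data.List using (List; []; _∷_; replicate; _++_)
open import Data.List.Relation.Unary.All using (All)
open import Data.Product using (_×_)
open import Relation.Binary.PropositionalEquality using (_≢_)
open import Data.Rational using (ℚ; mkℚ; 0ℚ; 1/_; _+_; _*_; _/_)

IsX : List ℕ → Set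
IsX xs = (xs ≢ []) × All (1 ≤_) xs

-- Total reciprocal on ℚ (1/0 := 0 by convention; never used at 0 below
-- for arguments coming from X).
recip : ℚ → ℚ
recip (mkℚ (+ zero) _ _) = 0ℚ
recip p@(mkℚ (+ suc n) _ _) = 1/ p
recip p@(mkℚ -[1+ n ] _ _) = 1/ p

cf0 : List ℕ → ℚ
cf0 [] = 0ℚ
cf0 (a ∷ []) = recip (+ a / 1)
cf0 (a ∷ rest@(_ ∷ _)) = recip ((+ a / 1) + cf0 rest)

incLast : List ℕ → List ℕ
incLast [] = []
incLast (a ∷ []) = suc a ∷ []
incLast (a ∷ rest@(_ ∷ _)) = a ∷ incLast rest

θ : List ℕ → ℚ
θ xs = cf0 (incLast xs)

-- Formal sequences: entries are either a number, or a block 1_m with m ∈ ℤ.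
data Tok : Set where
  num  : ℕ → Tok
  ones : ℤ → Tok

formalTail : List ℕ → List Tok
formalTail [] = []
formalTail (n ∷ []) = ones (n ⊖ 1) ∷ []
formalTail (n ∷ rest@(_ ∷ _)) = ones (n ⊖ 2) ∷ num 2 ∷ formalTail rest

-- (1_{n1-1}, 2, 1_{n2-2}, 2, ..., 2, 1_{nk-1})   (for k ≥ 2)
formal : List ℕ → List Tok
formal [] = []
formal (n ∷ rest) = ones (n ⊖ 1) ∷ num 2 ∷ formalTail rest

-- Reduction: 1_m (m ≥ 0) expands to m ones (so 1_0 is deleted), and
-- (…, a, 1_{-1}, b, …) becomes (…, a + b - 1, …).
mutual
  reduce : List Tok → List ℕ
  reduce [] = []
  reduce (num a ∷ rest) = reduceFrom a rest
  reduce (ones (+ m) ∷ rest) = replicate m 1 ++ reduce rest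
  reduce (ones -[1+ _ ] ∷ rest) = reduce rest  -- does not occur for inputs from X

  -- a pending number a, which may still be merged with what follows
  reduceFrom : ℕ → List Tok → List ℕ
  reduceFrom a (ones -[1+ zero ] ∷ num b ∷ rest) = reduceFrom ((a ℕ.+ b) ∸ 1) rest
  reduceFrom a rest = a ∷ reduce rest

J : List ℕ → List ℕ
J [] = []
J (n ∷ []) = replicate n 1
J xs@(_ ∷ _ ∷ _) = reduce (formal xs)

module Submission where

-- Since θ (1 ∷ x) = 1/(1 + θ x) and θ (incHead x) = θ x/(1 + θ x), the two identities say
-- that J swaps prepending a 1 with incrementing the first entry: J (1 ∷ x) = incHead (J x)
-- and J (incHead x) = 1 ∷ J x, both visible on the formal sequence. The hypotheses on y
-- and z pin them down because θ is injective on X: comparing integer parts of 1/θ peels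
-- off one partial quotient at a time.

open import Defs
open import Data.Nat using (ℕ)
open import Data.List using (List)
open import Data.Product using (_×_)
open import Relation.Binary.PropositionalEquality using (_≡_)
open import Data.Rational using (ℚ; _+_; _*_; 1ℚ)

open import Algebra.Properties.Group using (∙-cancelˡ)
open import Data.Empty using (⊥-elim)
open import Data.Integer using (+_; +[1+_]; -[1+_])
import Data.Integer as ℤ
import Data.Integer.Properties as ℤ
open import Data.List using ([]; _∷_; replicate)
open import Data.List.Properties using (++-identityʳ)
open import Data.List.Relation.Unary.All using (All; []; _∷_)
open import Data.Nat using (zero; suc; s≤s)
import Data.Nat as ℕ
import Data.Nat.Properties as ℕ
open import Data.Product using (_,_)
open import Data.Rational using (mkℚ; 0ℚ; _/_; *≤*; *<*; _≤_; _<_; Positive; positive)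
open import Data.Rational.Literals using (fromℤ)
open import Data.Rational.Properties
open import Function using (_∘_)
open import Relation.Binary.Definitions using (tri<; tri≈; tri>)
open import Relation.Binary.PropositionalEquality
  using (_≢_; refl; sym; trans; cong; cong₂; subst; subst₂; module ≡-Reasoning)

fromℕ : ℕ → ℚ
fromℕ n = fromℤ (+ n)

n/1≡fromℕ : ∀ n → + n / 1 ≡ fromℕ n
n/1≡fromℕ n = ↥p/↧p≡p (fromℕ n)

1+fromℕ : ∀ n → 1ℚ + fromℕ n ≡ fromℕ (suc n)
1+fromℕ zero = refl
1+fromℕ (suc n) = trans (cong (λ k → + suc k / 1) (ℕ.*-identityʳ (suc n))) (n/1≡fromℕ (suc (suc n)))

fromℕ-mono-≤ : ∀ {m n} → m ℕ.≤ n → fromℕ m ≤ fromℕ n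
fromℕ-mono-≤ {m} {n} m≤n = *≤* (subst₂ ℤ._≤_ (sym (ℤ.*-identityʳ (+ m))) (sym (ℤ.*-identityʳ (+ n))) (ℤ.+≤+ m≤n))

fromℕ-mono-< : ∀ {m n} → m ℕ.< n → fromℕ m < fromℕ n
fromℕ-mono-< {m} {n} m<n = *<* (subst₂ ℤ._<_ (sym (ℤ.*-identityʳ (+ m))) (sym (ℤ.*-identityʳ (+ n))) (ℤ.+<+ m<n))

fromℕ-injective : ∀ {m n} → fromℕ m ≡ fromℕ n → m ≡ n
fromℕ-injective refl = refl

fromℕ-nonNeg : ∀ n → 0ℚ ≤ fromℕ n
fromℕ-nonNeg n = nonNegative⁻¹ (fromℕ n)

fromℕ+frac<fromℕ+ : ∀ {m n t s} → m ℕ.< n → t < 1ℚ → 0ℚ ≤ s → fromℕ m + t < fromℕ n + s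
fromℕ+frac<fromℕ+ {m} {n} {t} {s} m<n t<1 0≤s = begin-strict
  fromℕ m + t    <⟨ +-monoʳ-< (fromℕ m) t<1 ⟩
  fromℕ m + 1ℚ   ≡⟨ trans (+-comm (fromℕ m) 1ℚ) (1+fromℕ m) ⟩
  fromℕ (suc m)  ≤⟨ fromℕ-mono-≤ m<n ⟩
  fromℕ n        ≡⟨ sym (+-identityʳ (fromℕ n)) ⟩
  fromℕ n + 0ℚ   ≤⟨ +-monoʳ-≤ (fromℕ n) 0≤s ⟩
  fromℕ n + s    ∎
  where open ≤-Reasoning

fromℕ+frac-injective : ∀ {m n t s} → 0ℚ ≤ t → t < 1ℚ → 0ℚ ≤ s → s < 1ℚ →
                       fromℕ m + t ≡ fromℕ n + s → m ≡ n × t ≡ s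
fromℕ+frac-injective {m} {n} {t} {s} 0≤t t<1 0≤s s<1 eq with ℕ.<-cmp m n
... | tri< m<n _ _ = ⊥-elim (<-irrefl eq (fromℕ+frac<fromℕ+ m<n t<1 0≤s))
... | tri≈ _ refl _ = refl , ∙-cancelˡ +-0-group (fromℕ m) t s eq
... | tri> _ _ n<m = ⊥-elim (<-irrefl (sym eq) (fromℕ+frac<fromℕ+ n<m s<1 0≤t))

recip-inverseʳ : ∀ p .{{_ : Positive p}} → p * recip p ≡ 1ℚ
recip-inverseʳ p@(mkℚ +[1+ _ ] _ _) = *-inverseʳ p

recip-pos : ∀ p .{{_ : Positive p}} → Positive (recip p)
recip-pos p@(mkℚ +[1+ _ ] _ _) = 1/pos⇒pos p

recip-involutive : ∀ p .{{_ : Positive p}} → recip (recip p) ≡ p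
recip-involutive p@(mkℚ +[1+ _ ] _ _) = 1/-involutive p

recip-unique : ∀ p q .{{_ : Positive p}} → p * q ≡ 1ℚ → q ≡ recip p
recip-unique p q pq≡1 = begin
  q                     ≡⟨ sym (*-identityˡ q) ⟩
  1ℚ * q                ≡⟨ cong (_* q) (sym (trans (*-comm (recip p) p) (recip-inverseʳ p))) ⟩
  (recip p * p) * q     ≡⟨ *-assoc (recip p) p q ⟩
  recip p * (p * q)     ≡⟨ cong (recip p *_) pq≡1 ⟩
  recip p * 1ℚ          ≡⟨ *-identityʳ (recip p) ⟩
  recip p               ∎
  where open ≡-Reasoning

1+-pos : ∀ p .{{_ : Positive p}} → Positive (1ℚ + p)
1+-pos p = pos+pos⇒pos 1ℚ p

recip-1+ : ∀ w .{{_ : Positive w}} → recip (1ℚ + w) ≡ recip w * recip (1ℚ + recip w)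
recip-1+ w = sym (recip-unique (1ℚ + w) (v * recip (1ℚ + v)) {{1+-pos w}} (begin
  (1ℚ + w) * (v * recip (1ℚ + v))   ≡⟨ sym (*-assoc (1ℚ + w) v _) ⟩
  ((1ℚ + w) * v) * recip (1ℚ + v)   ≡⟨ cong (_* recip (1ℚ + v)) (*-distribʳ-+ v 1ℚ w) ⟩
  (1ℚ * v + w * v) * recip (1ℚ + v) ≡⟨ cong₂ (λ a b → (a + b) * recip (1ℚ + v)) (*-identityˡ v) (recip-inverseʳ w) ⟩
  (v + 1ℚ) * recip (1ℚ + v)         ≡⟨ cong (_* recip (1ℚ + v)) (+-comm v 1ℚ) ⟩
  (1ℚ + v) * recip (1ℚ + v)         ≡⟨ recip-inverseʳ (1ℚ + v) {{1+-pos v {{recip-pos w}}}} ⟩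
  1ℚ                                ∎))
  where
  open ≡-Reasoning
  v = recip w

recip<1 : ∀ p → 1ℚ < p → recip p < 1ℚ
recip<1 p 1<p = *-cancelˡ-<-nonNeg p {{pos⇒nonNeg p}}
  (subst₂ _<_ (sym (recip-inverseʳ p)) (sym (*-identityʳ p)) 1<p)
  where instance _ = positive (<-trans (positive⁻¹ 1ℚ) 1<p)

θ-denom : ℕ → List ℕ → ℚ
θ-denom a [] = fromℕ (suc a)
θ-denom a r@(_ ∷ _) = fromℕ a + θ r

θ-∷ : ∀ a r → θ (a ∷ r) ≡ recip (θ-denom a r)
θ-∷ a [] = cong recip (n/1≡fromℕ (suc a))
θ-∷ a (b ∷ []) = cong (λ q → recip (q + θ (b ∷ []))) (n/1≡fromℕ a)
θ-∷ a (b ∷ c ∷ r) = cong (λ q → recip (q + θ (b ∷ c ∷ r))) (n/1≡fromℕ a)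

θ-denom-pos : ∀ a r → 0ℚ < θ-denom a r
θ-∷-pos : ∀ a r → 0ℚ < θ (a ∷ r)

θ-denom-pos a [] = positive⁻¹ (fromℕ (suc a))
θ-denom-pos a (b ∷ r) = subst (_< fromℕ a + θ (b ∷ r)) (+-identityˡ 0ℚ)
  (+-mono-≤-< (fromℕ-nonNeg a) (θ-∷-pos b r))

θ-∷-pos a r = subst (0ℚ <_) (sym (θ-∷ a r))
  (positive⁻¹ (recip (θ-denom a r)) {{recip-pos (θ-denom a r) {{positive (θ-denom-pos a r)}}}})

θ-∷<1 : ∀ {a} r → 1 ℕ.≤ a → θ (a ∷ r) < 1ℚ
θ-∷<1 {a} r 1≤a = subst (_< 1ℚ) (sym (θ-∷ a r)) (recip<1 (θ-denom a r) (1<θ-denom r))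
  where
  1<θ-denom : ∀ r → 1ℚ < θ-denom a r
  1<θ-denom [] = fromℕ-mono-< (s≤s 1≤a)
  1<θ-denom (b ∷ r) = subst (_< θ-denom a (b ∷ r)) (+-identityʳ 1ℚ)
    (+-mono-≤-< (fromℕ-mono-≤ 1≤a) (θ-∷-pos b r))

θ-denom-injective : ∀ a r b s → θ (a ∷ r) ≡ θ (b ∷ s) → θ-denom a r ≡ θ-denom b s
θ-denom-injective a r b s eq = begin
  θ-denom a r                  ≡⟨ sym (recip-involutive (θ-denom a r) {{positive (θ-denom-pos a r)}}) ⟩
  recip (recip (θ-denom a r))  ≡⟨ cong recip (trans (sym (θ-∷ a r)) (trans eq (θ-∷ b s))) ⟩
  recip (recip (θ-denom b s))  ≡⟨ recip-involutive (θ-denom b s) {{positive (θ-denom-pos b s)}} ⟩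
  θ-denom b s                  ∎
  where open ≡-Reasoning

θ-[]≢θ-∷∷ : ∀ {a b d} s → 1 ℕ.≤ d → θ (a ∷ []) ≢ θ (b ∷ d ∷ s)
θ-[]≢θ-∷∷ {a} {b} {d} s 1≤d eq
  with _ , 0≡θ ← fromℕ+frac-injective {suc a} {b} ≤-refl (positive⁻¹ 1ℚ) (<⇒≤ (θ-∷-pos d s)) (θ-∷<1 s 1≤d)
                   (trans (+-identityʳ _) (θ-denom-injective a [] b (d ∷ s) eq))
  = <-irrefl 0≡θ (θ-∷-pos d s)

θ-∷-injective : ∀ {a b r s} → All (1 ℕ.≤_) r → All (1 ℕ.≤_) s →
                θ (a ∷ r) ≡ θ (b ∷ s) → a ∷ r ≡ b ∷ s
θ-∷-injective {a} {b} {[]} {[]} _ _ eq =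
  cong (_∷ []) (ℕ.suc-injective (fromℕ-injective (θ-denom-injective a [] b [] eq)))
θ-∷-injective {a} {b} {[]} {d ∷ s} _ (1≤d ∷ _) eq = ⊥-elim (θ-[]≢θ-∷∷ {a} {b} s 1≤d eq)
θ-∷-injective {a} {b} {c ∷ r} {[]} (1≤c ∷ _) _ eq = ⊥-elim (θ-[]≢θ-∷∷ {b} {a} r 1≤c (sym eq))
θ-∷-injective {a} {b} {c ∷ r} {d ∷ s} (1≤c ∷ 1≤r) (1≤d ∷ 1≤s) eq
  with refl , θr≡θs ← fromℕ+frac-injective {a} {b} (<⇒≤ (θ-∷-pos c r)) (θ-∷<1 r 1≤c) (<⇒≤ (θ-∷-pos d s)) (θ-∷<1 s 1≤d)
                        (θ-denom-injective a (c ∷ r) b (d ∷ s) eq)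
  = cong (a ∷_) (θ-∷-injective 1≤r 1≤s θr≡θs)

θ-injective : ∀ {x y} → IsX x → IsX y → θ x ≡ θ y → x ≡ y
θ-injective {[]} (x≢[] , _) _ _ = ⊥-elim (x≢[] refl)
θ-injective {_ ∷ _} {[]} _ (y≢[] , _) _ = ⊥-elim (y≢[] refl)
θ-injective {_ ∷ _} {_ ∷ _} (_ , _ ∷ 1≤r) (_ , _ ∷ 1≤s) = θ-∷-injective 1≤r 1≤s

incHead : List ℕ → List ℕ
incHead [] = []
incHead (a ∷ r) = suc a ∷ r

θ-incHead : ∀ x → θ (incHead x) ≡ θ x * recip (1ℚ + θ x)
θ-incHead [] = refl
θ-incHead (a ∷ r) = begin
  θ (suc a ∷ r)                          ≡⟨ θ-∷ (suc a) r ⟩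
  recip (θ-denom (suc a) r)              ≡⟨ cong recip (θ-denom-suc r) ⟩
  recip (1ℚ + θ-denom a r)               ≡⟨ recip-1+ (θ-denom a r) {{positive (θ-denom-pos a r)}} ⟩
  recip w * recip (1ℚ + recip w)         ≡⟨ cong (λ q → q * recip (1ℚ + q)) (sym (θ-∷ a r)) ⟩
  θ (a ∷ r) * recip (1ℚ + θ (a ∷ r))     ∎
  where
  open ≡-Reasoning
  w = θ-denom a r
  θ-denom-suc : ∀ r → θ-denom (suc a) r ≡ 1ℚ + θ-denom a r
  θ-denom-suc [] = sym (1+fromℕ (suc a))
  θ-denom-suc (b ∷ r) = trans (cong (_+ θ (b ∷ r)) (sym (1+fromℕ a))) (+-assoc 1ℚ (fromℕ a) _)

θ-1∷ : ∀ {x} → x ≢ [] → θ (1 ∷ x) ≡ recip (1ℚ + θ x)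
θ-1∷ {[]} x≢[] = ⊥-elim (x≢[] refl)
θ-1∷ {a ∷ r} _ = θ-∷ 1 (a ∷ r)

IsX-1∷ : ∀ {x} → IsX x → IsX (1 ∷ x)
IsX-1∷ (_ , 1≤x) = (λ ()) , s≤s ℕ.z≤n ∷ 1≤x

IsX-incHead : ∀ {x} → IsX x → IsX (incHead x)
IsX-incHead {[]} (x≢[] , _) = ⊥-elim (x≢[] refl)
IsX-incHead {_ ∷ _} (_ , 1≤a ∷ 1≤r) = (λ ()) , ℕ.m≤n⇒m≤1+n 1≤a ∷ 1≤r

reduceFrom-nonEmpty : ∀ a ts → reduceFrom a ts ≢ []
reduceFrom-nonEmpty a (ones -[1+ zero ] ∷ num b ∷ ts) = reduceFrom-nonEmpty _ ts
reduceFrom-nonEmpty a (ones -[1+ zero ] ∷ ones _ ∷ ts) ()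
reduceFrom-nonEmpty a (ones -[1+ zero ] ∷ []) ()
reduceFrom-nonEmpty a (ones -[1+ suc _ ] ∷ ts) ()
reduceFrom-nonEmpty a (ones (+ _) ∷ ts) ()
reduceFrom-nonEmpty a (num _ ∷ ts) ()
reduceFrom-nonEmpty a [] ()

-- Every merge inside formalTail adds the entry 2, so the ∸ 1 in reduceFrom never
-- truncates and the extra 1 on the pending number survives.
reduceFrom-suc-formalTail : ∀ a ns →
  reduceFrom (suc a) (formalTail ns) ≡ incHead (reduceFrom a (formalTail ns))
reduceFrom-suc-formalTail a [] = refl
reduceFrom-suc-formalTail a (zero ∷ []) = refl
reduceFrom-suc-formalTail a (suc n ∷ []) = refl
reduceFrom-suc-formalTail a (zero ∷ m ∷ ns) = refl
reduceFrom-suc-formalTail a (suc zero ∷ m ∷ ns) =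
  subst (λ k → reduceFrom k (formalTail (m ∷ ns)) ≡ incHead (reduceFrom (k ℕ.∸ 1) (formalTail (m ∷ ns))))
        (ℕ.+-comm 2 a) (reduceFrom-suc-formalTail (suc a) (m ∷ ns))
reduceFrom-suc-formalTail a (suc (suc n) ∷ m ∷ ns) = refl

J-nonEmpty : ∀ {x} → IsX x → J x ≢ []
J-nonEmpty {[]} (x≢[] , _) = ⊥-elim (x≢[] refl)
J-nonEmpty {zero ∷ _} (_ , () ∷ _)
J-nonEmpty {suc n ∷ []} _ ()
J-nonEmpty {suc zero ∷ m ∷ ns} _ = reduceFrom-nonEmpty 2 (formalTail (m ∷ ns))
J-nonEmpty {suc (suc n) ∷ m ∷ ns} _ ()

J-1∷ : ∀ {x} → IsX x → J (1 ∷ x) ≡ incHead (J x)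
J-1∷ {[]} (x≢[] , _) = ⊥-elim (x≢[] refl)
J-1∷ {zero ∷ _} (_ , () ∷ _)
J-1∷ {suc n ∷ []} _ = cong (2 ∷_) (++-identityʳ (replicate n 1))
J-1∷ {suc zero ∷ m ∷ ns} _ = reduceFrom-suc-formalTail 2 (m ∷ ns)
J-1∷ {suc (suc n) ∷ m ∷ ns} _ = refl

J-incHead : ∀ {x} → IsX x → J (incHead x) ≡ 1 ∷ J x
J-incHead {[]} (x≢[] , _) = ⊥-elim (x≢[] refl)
J-incHead {zero ∷ _} (_ , () ∷ _)
J-incHead {suc n ∷ []} _ = refl
J-incHead {suc n ∷ m ∷ ns} _ = refl

mainTheorem2 : (x : List ℕ) → IsX x →
    ((y : List ℕ) → IsX y → θ y ≡ recip (1ℚ + θ x) →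
      θ (J y) ≡ θ (J x) * recip (1ℚ + θ (J x)))
    × ((z : List ℕ) → IsX z → θ z ≡ θ x * recip (1ℚ + θ x) →
      θ (J z) ≡ recip (1ℚ + θ (J x)))
mainTheorem2 x X@(x≢[] , _) = J-at-1/[1+x] , J-at-x/[1+x]
  where
  open ≡-Reasoning
  J-at-1/[1+x] : (y : List ℕ) → IsX y → θ y ≡ recip (1ℚ + θ x) →
                 θ (J y) ≡ θ (J x) * recip (1ℚ + θ (J x))
  J-at-1/[1+x] y Y θy≡ = begin
    θ (J y)            ≡⟨ cong (θ ∘ J) (θ-injective Y (IsX-1∷ X) (trans θy≡ (sym (θ-1∷ x≢[])))) ⟩
    θ (J (1 ∷ x))      ≡⟨ cong θ (J-1∷ X) ⟩
    θ (incHead (J x))  ≡⟨ θ-incHead (J x) ⟩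
    θ (J x) * recip (1ℚ + θ (J x)) ∎
  J-at-x/[1+x] : (z : List ℕ) → IsX z → θ z ≡ θ x * recip (1ℚ + θ x) →
                 θ (J z) ≡ recip (1ℚ + θ (J x))
  J-at-x/[1+x] z Z θz≡ = begin
    θ (J z)            ≡⟨ cong (θ ∘ J) (θ-injective Z (IsX-incHead X) (trans θz≡ (sym (θ-incHead x)))) ⟩
    θ (J (incHead x))  ≡⟨ cong θ (J-incHead X) ⟩
    θ (1 ∷ J x)        ≡⟨ θ-1∷ (J-nonEmpty X) ⟩
    recip (1ℚ + θ (J x)) ∎
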